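{- Let $q$ and $q+1$ both be prime powers, and let $N_\beta$ ($\beta\in\mathbb{F}_{q+1}^*$) be the $(0,1)$-matrices defined in the context. Then: (i) for any $\beta\in\mathbb{F}_{q+1}^*$, $N_\beta^\top=N_{ -\beta}$; (ii) for any $\beta\in\mathbb{F}_{q+1}^*$, $N_\beta N_{ -\beta}=q^2I_{(q+1)q^2}-qI_{(q+1)q}\otimes J_q+I_{q+1}\otimes J_{q^2}+(q-1)J_{(q+1)q^2}$; (iii) for any $\beta,\beta'\in\mathbb{F}_{q+1}^*$ with $\beta+\beta'\neq0$, $N_\beta N_{\beta'}=qN_{\frac{\beta\beta'}{\beta+\beta'}}+2I_{q+1}\otimes J_{q^2}+(q-2)J_{(q+1)q^2}$; (iv) for any $\beta\in\mathbb{F}_{q+1}^*$, $N_\beta(I_{(q+1)q}\otimes J_q)=(I_{(q+1)q}\otimes J_q)N_\beta=J_{(q+1)q^2}-I_{q+1}\otimes J_{q^2}$; (v) for any $\beta\in\mathbb{F}_{q+1}^*$, $N_\beta(I_{q+1}\otimes J_{q^2})=(I_{q+1}\otimes J_{q^2})N_\beta=q(J_{(q+1)q^2}-I_{q+1}\otimes J_{q^2})$; (vi) $\sum_{\beta\in\mathbb{F}_{q+1}^*}N_\beta=(J_{q+1}-I_{q+1})\otimes(qI_{q^2}+(J_q-I_q)\otimes J_q)$.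
   Context: $I_n,J_n$ are the identity and all-ones matrices of order $n$, $\mathbb{F}_r^*=\mathbb{F}_r\setminus\{0\}$, $\otimes$ is the Kronecker product. Let $x$ be a new symbol and fix a bijection $\varphi:\mathbb{F}_{q+1}\to\mathbb{F}_q\cup\{x\}$ with $\varphi(0)=x$. Matrices of order $(q+1)q^2$ have rows and columns indexed by $\mathbb{F}_{q+1}\times\mathbb{F}_q\times\mathbb{F}_q$ in lexicographic order (compatible with Kronecker products of matrices indexed by $\mathbb{F}_{q+1}$, $\mathbb{F}_q$, $\mathbb{F}_q$). For $\beta\in\mathbb{F}_{q+1}^*$, $N_\beta$ is the $(0,1)$-matrix whose $((b,a_1,a_2),(b',a_1',a_2'))$-entry is $1$ if $c=\varphi(\beta(b'-b))$ lies in $\mathbb{F}_q$ and $a_2'-a_2=c(a_1'-a_1)$, and $0$ otherwise (in particular $0$ whenever $b=b'$). -}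

module Defs where

open import Level using (0ℓ)
open import Data.Nat using (ℕ)
import Data.Nat as ℕ
open import Data.Fin using (Fin)
import Data.Fin as Fin
open import Data.Fin.Properties using () renaming (_≟_ to _≟ᶠ_)
open import Data.Integer using (ℤ; +_; _+_; _*_; -_; _-_)
open import Data.Maybe using (Maybe; just; nothing)
open import Data.Product using (_×_; _,_; Σ)
open import Data.List using (List; map; foldr; allFin)
open import Function.Bundles using (_↔_; Inverse)
open import Relation.Binary.PropositionalEquality using (_≡_; _≢_; refl; cong; sym; trans)
open import Relation.Binary.Definitions using (DecidableEquality)
open import Relation.Nullary using (yes; no; Dec)
open import Algebra.Structures using (IsCommutativeRing)

record FiniteField (n : ℕ) : Set₁ where
  infixl 6 _+ᶠ_
  infixl 7 _*ᶠ_
  field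
    Carrier   : Set
    _+ᶠ_ _*ᶠ_ : Carrier → Carrier → Carrier
    -ᶠ_       : Carrier → Carrier
    0ᶠ 1ᶠ     : Carrier
    _⁻¹       : Carrier → Carrier
    isCommutativeRing : IsCommutativeRing _≡_ _+ᶠ_ _*ᶠ_ -ᶠ_ 0ᶠ 1ᶠ
    0≢1       : 0ᶠ ≢ 1ᶠ
    ⁻¹-inverse : ∀ x → x ≢ 0ᶠ → x *ᶠ (x ⁻¹) ≡ 1ᶠ
    enumeration : Fin n ↔ Carrier

  _-ᶠ_ : Carrier → Carrier → Carrier
  x -ᶠ y = x +ᶠ (-ᶠ y)

  _≟_ : DecidableEquality Carrier
  x ≟ y with Inverse.from enumeration x ≟ᶠ Inverse.from enumeration y
  ... | yes p = yes (trans (sym (Inverse.strictlyInverseˡ enumeration x))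
                      (trans (cong (Inverse.to enumeration) p)
                             (Inverse.strictlyInverseˡ enumeration y)))
  ... | no ¬p = no (λ e → ¬p (cong (Inverse.from enumeration) e))

  elements : List Carrier
  elements = map (Inverse.to enumeration) (allFin n)

sumOver : List ℤ → ℤ
sumOver = foldr _+_ (+ 0)

module _ {n : ℕ} (F : FiniteField n) where
  open FiniteField F

  Σ[_] : (Carrier → ℤ) → ℤ
  Σ[_] f = sumOver (map f elements)

  δ : Carrier → Carrier → ℤ
  δ x y with x ≟ y
  ... | yes _ = + 1
  ... | no  _ = + 0

-- Setting of the paper: F = 𝔽_q, K = 𝔽_{q+1}, and a bijection
-- φ : K → F ∪ {x}, where F ∪ {x} is represented as Maybe F (x = nothing).

module Setting {q : ℕ} (F : FiniteField q) (K : FiniteField (ℕ.suc q))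
  (φ : FiniteField.Carrier K → Maybe (FiniteField.Carrier F)) where

  open FiniteField F using () renaming
    (Carrier to 𝔽; _+ᶠ_ to _+F_; _*ᶠ_ to _*F_; _-ᶠ_ to _-F_; _≟_ to _≟F_)
  open FiniteField K using () renaming
    (Carrier to 𝕂; _*ᶠ_ to _*K_; _-ᶠ_ to _-K_)

  Idx : Set
  Idx = 𝕂 × 𝔽 × 𝔽

  Mat : Set
  Mat = Idx → Idx → ℤ

  _·_ : Mat → Mat → Mat
  (A · B) i j = Σ[ K ] λ b → Σ[ F ] λ a₁ → Σ[ F ] λ a₂ → A i (b , a₁ , a₂) * B (b , a₁ , a₂) j

  _⊕_ : Mat → Mat → Mat
  (A ⊕ B) i j = A i j + B i j

  _⊖_ : Mat → Mat → Mat
  (A ⊖ B) i j = A i j - B i j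

  _⊙_ : ℤ → Mat → Mat
  (c ⊙ A) i j = c * A i j

  transpose : Mat → Mat
  transpose A i j = A j i

  ΣK* : (𝕂 → Mat) → Mat
  ΣK* M i j = Σ[ K ] λ β → (+ 1 - δ K β (FiniteField.0ᶠ K)) * M β i j

  Iₘ : Mat
  Iₘ (b , a₁ , a₂) (b' , a₁' , a₂') = δ K b b' * δ F a₁ a₁' * δ F a₂ a₂'

  Jₘ : Mat
  Jₘ _ _ = + 1

  I⊗Jq : Mat
  I⊗Jq (b , a₁ , a₂) (b' , a₁' , a₂') = δ K b b' * δ F a₁ a₁' * + 1

  I⊗Jq² : Mat
  I⊗Jq² (b , a₁ , a₂) (b' , a₁' , a₂') = δ K b b' * + 1

  -- (J_{q+1} - I_{q+1}) ⊗ (q I_{q²} + (J_q - I_q) ⊗ J_q)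
  rhs-vi : Mat
  rhs-vi (b , a₁ , a₂) (b' , a₁' , a₂') =
    (+ 1 - δ K b b')
      * ((+ q) * (δ F a₁ a₁' * δ F a₂ a₂') + (+ 1 - δ F a₁ a₁') * + 1)

  N : 𝕂 → Mat
  N β (b , a₁ , a₂) (b' , a₁' , a₂') with φ (β *K (b' -K b))
  ... | nothing = + 0
  ... | just c with (a₂' -F a₂) ≟F (c *F (a₁' -F a₁))
  ...   | yes _ = + 1
  ...   | no  _ = + 0

  _≋_ : Mat → Mat → Set
  A ≋ B = ∀ i j → A i j ≡ B i j

  0K : 𝕂
  0K = FiniteField.0ᶠ K

  _+K_ : 𝕂 → 𝕂 → 𝕂
  _+K_ = FiniteField._+ᶠ_ K

  _×K_ : 𝕂 → 𝕂 → 𝕂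
  _×K_ = FiniteField._*ᶠ_ K

  negK : 𝕂 → 𝕂
  negK = FiniteField.-ᶠ_ K

  _/K_ : 𝕂 → 𝕂 → 𝕂
  x /K y = x ×K (FiniteField._⁻¹ K y)

module Submission where

-- Writing an index as (b, p) with p a point of the affine plane F²,
-- the entry of N_β at ((b, p), (b', p')) says that p' lies on the line through
-- p of slope φ(β(b' - b)) (no line when b = b', since φ 0 = x).  Hence
--   * (N_β N_β')((b,p),(b'',p'')) = Σ_{b'} #{two-step paths p → r → p''} along
--     the slopes φ(β(b' - b)), φ(β'(b'' - b')): two lines of equal slope share
--     q points or none, lines of different slopes meet exactly once;
--   * as y runs over K, φ(u(y - v)) (u ≠ 0) runs over F ∪ {x} once each, so
--     summing incidences over a pencil counts the lines joining p and p''.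
-- Everything reduces to sums of Kronecker deltas of affine equations over F
-- and K, each of which has exactly one solution.

open import Defs
open import Data.Nat using (ℕ; suc)
open import Data.Integer using (+_; _-_)
open import Data.Maybe using (Maybe; nothing)
open import Data.Product using (_×_; _,_)
open import Function.Definitions using (Bijective)
open import Relation.Binary.PropositionalEquality using (_≡_; _≢_)

open import Level using (0ℓ)
open import Data.Nat as ℕ using (zero)
import Data.Nat.Properties as ℕP
open import Data.Integer as ℤ using (ℤ; -[1+_]; _◃_; sign; ∣_∣; _+_; _*_; -_)
open import Data.Integer using () renaming (_+_ to _+ℤ_)
import Data.Integer.Properties as ℤP
open import Data.Integer.Tactic.RingSolver using (solve-∀)
import Data.Sign as Sign
open import Data.Fin using (Fin; punchIn)
open import Data.Fin.Properties using (punchInᵢ≢i)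
open import Data.List using (tabulate)
open import Data.List.Properties using (map-tabulate)
open import Data.Maybe using (just)
open import Data.Product using (proj₁; proj₂; ∃)
open import Data.Empty using (⊥-elim)
open import Function using (_∘_; id)
open import Function.Bundles using (Inverse)
open import Relation.Binary.PropositionalEquality using (refl; sym; trans; cong; cong₂; module ≡-Reasoning)
open import Relation.Nullary using (Dec; yes; no)
open import Algebra.Bundles using (CommutativeRing)
open import Algebra.Structures using (IsCommutativeRing)
import Algebra.Properties.Ring as RingProperties
import Algebra.Properties.Group as GroupProperties
import Algebra.Properties.Semiring.Mult as SemiringMultiplication
import Algebra.Properties.CommutativeSemigroup as CommutativeSemigroupProperties
import Algebra.Solver.Ring.AlmostCommutativeRing as AlmostCommutativeRing
import Algebra.Solver.Ring as RingSolver
open import Algebra.Properties.Semiring.Sum ℤP.+-*-semiring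
  using (sum; sum-cong-≗; ∑-distrib-+; *-distribˡ-sum; sum-remove; sum-replicate-zero)

-- The normalising ring solver of the library, instantiated for an arbitrary
-- commutative ring with propositional equality and integer coefficients:
-- the coefficients are computed in ℤ, so identities that rely on the
-- cancellation of integer constants (x - x = 0, 2x - x = x, ...) are decided.
module IntegerRingSolver {A : Set} {_+ᴬ_ _*ᴬ_ : A → A → A} { -ᴬ_ : A → A} {0ᴬ 1ᴬ : A}
  (isCommutativeRing : IsCommutativeRing _≡_ _+ᴬ_ _*ᴬ_ -ᴬ_ 0ᴬ 1ᴬ) where

  R : CommutativeRing 0ℓ 0ℓ
  R = record { isCommutativeRing = isCommutativeRing }

  open CommutativeRing R using (ring; semiring; +-commutativeSemigroup; +-comm;
    +-identityˡ; +-identityʳ; -‿inverseʳ)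
  open RingProperties ring using (-‿involutive; -‿distribˡ-*; -‿distribʳ-*; -0#≈0#; -‿anti-homo-+)
  open SemiringMultiplication semiring using (×-homo-+; ×1-homo-*) renaming (_×_ to _×ᴬ_)
  open CommutativeSemigroupProperties +-commutativeSemigroup using (interchange)
  open ≡-Reasoning

  nat : ℕ → A
  nat n = n ×ᴬ 1ᴬ

  int : ℤ → A
  int (+ n)    = nat n
  int -[1+ n ] = -ᴬ nat (suc n)

  signed : Sign.Sign → A → A
  signed Sign.+ x = x
  signed Sign.- x = -ᴬ x

  int-signed : ∀ s n → int (s ◃ n) ≡ signed s (nat n)
  int-signed Sign.+ zero    = refl
  int-signed Sign.- zero    = sym -0#≈0#
  int-signed Sign.+ (suc n) = refl
  int-signed Sign.- (suc n) = refl

  signed-* : ∀ s t x y → signed (s Sign.* t) (x *ᴬ y) ≡ signed s x *ᴬ signed t y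
  signed-* Sign.+ Sign.+ x y = refl
  signed-* Sign.+ Sign.- x y = -‿distribʳ-* x y
  signed-* Sign.- Sign.+ x y = -‿distribˡ-* x y
  signed-* Sign.- Sign.- x y = begin
    x *ᴬ y                 ≡⟨ -‿involutive (x *ᴬ y) ⟨
    -ᴬ (-ᴬ (x *ᴬ y))       ≡⟨ cong -ᴬ_ (-‿distribˡ-* x y) ⟩
    -ᴬ ((-ᴬ x) *ᴬ y)       ≡⟨ -‿distribʳ-* (-ᴬ x) y ⟩
    (-ᴬ x) *ᴬ (-ᴬ y)       ∎

  int-⊖ : ∀ m n → int (m ℤ.⊖ n) ≡ nat m +ᴬ (-ᴬ nat n)
  int-⊖ zero    zero    = sym (trans (cong (0ᴬ +ᴬ_) -0#≈0#) (+-identityˡ 0ᴬ))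
  int-⊖ (suc m) zero    = sym (trans (cong (nat (suc m) +ᴬ_) -0#≈0#) (+-identityʳ _))
  int-⊖ zero    (suc n) = sym (+-identityˡ _)
  int-⊖ (suc m) (suc n) = begin
    int (suc m ℤ.⊖ suc n)                         ≡⟨ cong int (ℤP.[1+m]⊖[1+n]≡m⊖n m n) ⟩
    int (m ℤ.⊖ n)                                 ≡⟨ int-⊖ m n ⟩
    nat m +ᴬ (-ᴬ nat n)                           ≡⟨ +-identityˡ _ ⟨
    0ᴬ +ᴬ (nat m +ᴬ (-ᴬ nat n))                   ≡⟨ cong (_+ᴬ (nat m +ᴬ (-ᴬ nat n))) (-‿inverseʳ 1ᴬ) ⟨
    (1ᴬ +ᴬ (-ᴬ 1ᴬ)) +ᴬ (nat m +ᴬ (-ᴬ nat n))     ≡⟨ interchange 1ᴬ (-ᴬ 1ᴬ) (nat m) (-ᴬ nat n) ⟩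
    (1ᴬ +ᴬ nat m) +ᴬ ((-ᴬ 1ᴬ) +ᴬ (-ᴬ nat n))     ≡⟨ cong ((1ᴬ +ᴬ nat m) +ᴬ_) (trans (-‿anti-homo-+ 1ᴬ (nat n)) (+-comm _ _)) ⟨
    (1ᴬ +ᴬ nat m) +ᴬ (-ᴬ (1ᴬ +ᴬ nat n))          ∎

  int-+ : ∀ i j → int (i ℤ.+ j) ≡ int i +ᴬ int j
  int-+ (+ m)    (+ n)    = ×-homo-+ 1ᴬ m n
  int-+ (+ m)    -[1+ n ] = int-⊖ m (suc n)
  int-+ -[1+ m ] (+ n)    = trans (int-⊖ n (suc m)) (+-comm _ _)
  int-+ -[1+ m ] -[1+ n ] = begin
    -ᴬ nat (suc (suc (m ℕ.+ n)))            ≡⟨ cong (λ k → -ᴬ nat (suc k)) (ℕP.+-suc m n) ⟨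
    -ᴬ nat (suc m ℕ.+ suc n)                ≡⟨ cong -ᴬ_ (×-homo-+ 1ᴬ (suc m) (suc n)) ⟩
    -ᴬ (nat (suc m) +ᴬ nat (suc n))         ≡⟨ -‿anti-homo-+ _ _ ⟩
    (-ᴬ nat (suc n)) +ᴬ (-ᴬ nat (suc m))    ≡⟨ +-comm _ _ ⟩
    (-ᴬ nat (suc m)) +ᴬ (-ᴬ nat (suc n))    ∎

  -- ℤ multiplication is defined through signs and absolute values
  int-* : ∀ i j → int (i ℤ.* j) ≡ int i *ᴬ int j
  int-* i j = begin
    int (i ℤ.* j)                                            ≡⟨ int-signed (sign i Sign.* sign j) (∣ i ∣ ℕ.* ∣ j ∣) ⟩
    signed (sign i Sign.* sign j) (nat (∣ i ∣ ℕ.* ∣ j ∣))    ≡⟨ cong (signed (sign i Sign.* sign j)) (×1-homo-* ∣ i ∣ ∣ j ∣) ⟩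
    signed (sign i Sign.* sign j) (nat ∣ i ∣ *ᴬ nat ∣ j ∣)   ≡⟨ signed-* (sign i) (sign j) _ _ ⟩
    signed (sign i) (nat ∣ i ∣) *ᴬ signed (sign j) (nat ∣ j ∣) ≡⟨ cong₂ _*ᴬ_ (signed-abs i) (signed-abs j) ⟩
    int i *ᴬ int j                                           ∎
    where
    signed-abs : ∀ k → signed (sign k) (nat ∣ k ∣) ≡ int k
    signed-abs (+ n)    = refl
    signed-abs -[1+ n ] = refl

  int-neg : ∀ i → int (ℤ.- i) ≡ -ᴬ int i
  int-neg (+ zero)  = sym -0#≈0#
  int-neg (+ suc n) = refl
  int-neg -[1+ n ]  = sym (-‿involutive _)

  ring-morphism : CommutativeRing.rawRing ℤP.+-*-commutativeRing
    AlmostCommutativeRing.-Raw-AlmostCommutative⟶ AlmostCommutativeRing.fromCommutativeRing R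
  ring-morphism = record
    { ⟦_⟧ = int ; +-homo = int-+ ; *-homo = int-* ; -‿homo = int-neg
    ; 0-homo = refl ; 1-homo = +-identityʳ 1ᴬ }

  int-≟ : ∀ i j → Maybe (int i ≡ int j)
  int-≟ i j with i ℤ.≟ j
  ... | yes i≡j = just (cong int i≡j)
  ... | no  _   = nothing

  open RingSolver _ (AlmostCommutativeRing.fromCommutativeRing R) ring-morphism int-≟ public
    using (solve; _:+_; _:*_; _:-_; :-_; _:=_; con)

module FiniteSums {n : ℕ} (F : FiniteField n) where
  open FiniteField F
  open ≡-Reasoning

  private
    to : Fin n → Carrier
    to = Inverse.to enumeration

    from : Carrier → Fin n
    from = Inverse.from enumeration

    sumOver-tabulate : ∀ {m} (h : Fin m → ℤ) → sumOver (tabulate h) ≡ sum h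
    sumOver-tabulate {zero}  h = refl
    sumOver-tabulate {suc m} h = cong (h Fin.zero +ℤ_) (sumOver-tabulate (h ∘ Fin.suc))

    sum-single : ∀ {m} (h : Fin m → ℤ) i → (∀ j → j ≢ i → h j ≡ + 0) → sum h ≡ h i
    sum-single {suc m} h i vanish = begin
      sum h                         ≡⟨ sum-remove {i = i} h ⟩
      h i + sum (h ∘ punchIn i) ≡⟨ cong (h i +ℤ_) (sum-cong-≗ (λ j → vanish _ (punchInᵢ≢i i j))) ⟩
      h i + sum {m} (λ _ → + 0)     ≡⟨ cong (h i +ℤ_) (sum-replicate-zero m) ⟩
      h i + + 0                     ≡⟨ ℤP.+-identityʳ (h i) ⟩
      h i                           ∎

  Σ-as-sum : ∀ (f : Carrier → ℤ) → Σ[ F ] f ≡ sum (f ∘ to)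
  Σ-as-sum f = trans (cong sumOver (trans (cong (Data.List.map f) (map-tabulate id to))
                                          (map-tabulate to f)))
                     (sumOver-tabulate (f ∘ to))

  Σ-cong : ∀ {f g : Carrier → ℤ} → (∀ x → f x ≡ g x) → Σ[ F ] f ≡ Σ[ F ] g
  Σ-cong {f} {g} f≗g = begin
    Σ[ F ] f      ≡⟨ Σ-as-sum f ⟩
    sum (f ∘ to)  ≡⟨ sum-cong-≗ (f≗g ∘ to) ⟩
    sum (g ∘ to)  ≡⟨ Σ-as-sum g ⟨
    Σ[ F ] g      ∎

  Σ-+ : ∀ (f g : Carrier → ℤ) → Σ[ F ] (λ x → f x + g x) ≡ Σ[ F ] f + Σ[ F ] g
  Σ-+ f g = begin
    Σ[ F ] (λ x → f x + g x)      ≡⟨ Σ-as-sum _ ⟩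
    sum (λ i → f (to i) + g (to i)) ≡⟨ ∑-distrib-+ (f ∘ to) (g ∘ to) ⟩
    sum (f ∘ to) + sum (g ∘ to)   ≡⟨ cong₂ _+_ (Σ-as-sum f) (Σ-as-sum g) ⟨
    Σ[ F ] f + Σ[ F ] g           ∎

  Σ-*ˡ : ∀ c (f : Carrier → ℤ) → Σ[ F ] (λ x → c * f x) ≡ c * Σ[ F ] f
  Σ-*ˡ c f = begin
    Σ[ F ] (λ x → c * f x)   ≡⟨ Σ-as-sum _ ⟩
    sum (λ i → c * f (to i)) ≡⟨ *-distribˡ-sum c (f ∘ to) ⟨
    c * sum (f ∘ to)         ≡⟨ cong (c *_) (Σ-as-sum f) ⟨
    c * Σ[ F ] f             ∎

  Σ-- : ∀ (f g : Carrier → ℤ) → Σ[ F ] (λ x → f x - g x) ≡ Σ[ F ] f - Σ[ F ] g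
  Σ-- f g = begin
    Σ[ F ] (λ x → f x - g x)                 ≡⟨ Σ-+ f (λ x → - g x) ⟩
    Σ[ F ] f + Σ[ F ] (λ x → - g x)          ≡⟨ cong (Σ[ F ] f +ℤ_) (Σ-cong (λ x → ℤP.-1*i≡-i (g x))) ⟨
    Σ[ F ] f + Σ[ F ] (λ x → ℤ.-1ℤ * g x)    ≡⟨ cong (Σ[ F ] f +ℤ_) (Σ-*ˡ ℤ.-1ℤ g) ⟩
    Σ[ F ] f + ℤ.-1ℤ * Σ[ F ] g              ≡⟨ cong (Σ[ F ] f +ℤ_) (ℤP.-1*i≡-i (Σ[ F ] g)) ⟩
    Σ[ F ] f - Σ[ F ] g                      ∎

  Σ-const : ∀ c → Σ[ F ] (λ _ → c) ≡ + n * c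
  Σ-const c = trans (Σ-as-sum (λ _ → c)) (sum-const n)
    where
    sum-const : ∀ m → sum {m} (λ _ → c) ≡ + m * c
    sum-const zero    = refl
    sum-const (suc m) = trans (cong (c +ℤ_) (sum-const m)) (sym (ℤP.suc-* (+ m) c))

  Σ-zero : ∀ (f : Carrier → ℤ) → (∀ x → f x ≡ + 0) → Σ[ F ] f ≡ + 0
  Σ-zero f f≗0 = trans (Σ-cong f≗0) (trans (Σ-const (+ 0)) (ℤP.*-zeroʳ (+ n)))

  δ-yes : ∀ {x y} → x ≡ y → δ F x y ≡ + 1
  δ-yes {x} {y} x≡y with x ≟ y
  ... | yes _   = refl
  ... | no  x≢y = ⊥-elim (x≢y x≡y)

  δ-no : ∀ {x y} → x ≢ y → δ F x y ≡ + 0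
  δ-no {x} {y} x≢y with x ≟ y
  ... | yes x≡y = ⊥-elim (x≢y x≡y)
  ... | no  _   = refl

  δ-iff : ∀ {x y x' y'} → (x ≡ y → x' ≡ y') → (x' ≡ y' → x ≡ y) → δ F x y ≡ δ F x' y'
  δ-iff {x} {y} to' from' with x ≟ y
  ... | yes x≡y = sym (δ-yes (to' x≡y))
  ... | no  x≢y = sym (δ-no (x≢y ∘ from'))

  δ-sym : ∀ (x y : Carrier) → δ F x y ≡ δ F y x
  δ-sym x y = δ-iff sym sym

  Σ-δ* : ∀ (a : Carrier) (g : Carrier → ℤ) → Σ[ F ] (λ x → δ F x a * g x) ≡ g a
  Σ-δ* a g = begin
    Σ[ F ] (λ x → δ F x a * g x)          ≡⟨ Σ-as-sum (λ x → δ F x a * g x) ⟩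
    sum (λ i → δ F (to i) a * g (to i))   ≡⟨ sum-single (λ i → δ F (to i) a * g (to i)) (from a) vanish ⟩
    δ F (to (from a)) a * g (to (from a)) ≡⟨ cong (λ x → δ F x a * g x) (Inverse.strictlyInverseˡ enumeration a) ⟩
    δ F a a * g a                         ≡⟨ cong (_* g a) (δ-yes refl) ⟩
    + 1 * g a                             ≡⟨ ℤP.*-identityˡ (g a) ⟩
    g a                                   ∎
    where
    vanish : ∀ j → j ≢ from a → δ F (to j) a * g (to j) ≡ + 0
    vanish j j≢ = cong (_* g (to j)) (δ-no (λ e → j≢ (trans (sym (Inverse.strictlyInverseʳ enumeration j)) (cong from e))))

  Σ-*δ : ∀ (a : Carrier) (g : Carrier → ℤ) → Σ[ F ] (λ x → g x * δ F x a) ≡ g a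
  Σ-*δ a g = trans (Σ-cong (λ x → ℤP.*-comm (g x) (δ F x a))) (Σ-δ* a g)

  Σ-*ʳ : ∀ (f : Carrier → ℤ) c → Σ[ F ] (λ x → f x * c) ≡ Σ[ F ] f * c
  Σ-*ʳ f c = begin
    Σ[ F ] (λ x → f x * c)  ≡⟨ Σ-cong (λ x → ℤP.*-comm (f x) c) ⟩
    Σ[ F ] (λ x → c * f x)  ≡⟨ Σ-*ˡ c f ⟩
    c * Σ[ F ] f            ≡⟨ ℤP.*-comm c (Σ[ F ] f) ⟩
    Σ[ F ] f * c            ∎

  Σ-δ : ∀ (a : Carrier) → Σ[ F ] (λ x → δ F x a) ≡ + 1
  Σ-δ a = begin
    Σ[ F ] (λ x → δ F x a)         ≡⟨ Σ-cong (λ x → ℤP.*-identityʳ (δ F x a)) ⟨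
    Σ[ F ] (λ x → δ F x a * + 1)   ≡⟨ Σ-δ* a (λ _ → + 1) ⟩
    + 1                            ∎

module FieldFacts {n : ℕ} (F : FiniteField n) where
  open FiniteField F
  open FiniteSums F public
  open IntegerRingSolver isCommutativeRing public using (solve; _:+_; _:*_; _:-_; :-_; _:=_; con)
  open IntegerRingSolver isCommutativeRing using (R)
  open CommutativeRing R using (+-group; *-identityˡ; zeroˡ; *-comm)
  open GroupProperties +-group using (x∙y⁻¹≈ε⇒x≈y; x≈y⇒x∙y⁻¹≈ε)
  open ≡-Reasoning

  diff≡0⇒≡ : ∀ {x y} → x -ᶠ y ≡ 0ᶠ → x ≡ y
  diff≡0⇒≡ {x} {y} = x∙y⁻¹≈ε⇒x≈y x y

  δ-diff : ∀ (x y : Carrier) → δ F x y ≡ δ F (x -ᶠ y) 0ᶠ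
  δ-diff x y = δ-iff x≈y⇒x∙y⁻¹≈ε diff≡0⇒≡

  δ-sub : ∀ {x y x' y' : Carrier} → x -ᶠ y ≡ x' -ᶠ y' → δ F x y ≡ δ F x' y'
  δ-sub {x} {y} {x'} {y'} same-difference = begin
    δ F x y                ≡⟨ δ-diff x y ⟩
    δ F (x -ᶠ y) 0ᶠ        ≡⟨ cong (λ d → δ F d 0ᶠ) same-difference ⟩
    δ F (x' -ᶠ y') 0ᶠ      ≡⟨ δ-diff x' y' ⟨
    δ F x' y'              ∎

  neg-zero : -ᶠ 0ᶠ ≡ 0ᶠ
  neg-zero = solve 0 (:- con (+ 0) := con (+ 0)) refl

  neg≡0⇒≡0 : ∀ {x} → -ᶠ x ≡ 0ᶠ → x ≡ 0ᶠ
  neg≡0⇒≡0 {x} -x≡0 = trans (solve 1 (λ x → x := :- (:- x)) refl x) (trans (cong -ᶠ_ -x≡0) neg-zero)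

  neg-nonzero : ∀ {u} → u ≢ 0ᶠ → -ᶠ u ≢ 0ᶠ
  neg-nonzero u≢0 = u≢0 ∘ neg≡0⇒≡0

  δ-neg : ∀ (x : Carrier) → δ F (-ᶠ x) 0ᶠ ≡ δ F x 0ᶠ
  δ-neg x = δ-iff neg≡0⇒≡0 (λ x≡0 → trans (cong -ᶠ_ x≡0) neg-zero)

  linear-unique : ∀ {k t e} → k ≢ 0ᶠ → k *ᶠ t ≡ e → t ≡ e *ᶠ k ⁻¹
  linear-unique {k} {t} {e} k≢0 kt≡e = begin
    t                      ≡⟨ *-identityˡ t ⟨
    1ᶠ *ᶠ t                ≡⟨ cong (_*ᶠ t) (⁻¹-inverse k k≢0) ⟨
    (k *ᶠ k ⁻¹) *ᶠ t       ≡⟨ solve 3 (λ k u t → (k :* u) :* t := (k :* t) :* u) refl k (k ⁻¹) t ⟩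
    (k *ᶠ t) *ᶠ k ⁻¹       ≡⟨ cong (_*ᶠ k ⁻¹) kt≡e ⟩
    e *ᶠ k ⁻¹              ∎

  linear-solution : ∀ {k} e → k ≢ 0ᶠ → k *ᶠ (e *ᶠ k ⁻¹) ≡ e
  linear-solution {k} e k≢0 = begin
    k *ᶠ (e *ᶠ k ⁻¹)       ≡⟨ solve 3 (λ k u e → k :* (e :* u) := (k :* u) :* e) refl k (k ⁻¹) e ⟩
    (k *ᶠ k ⁻¹) *ᶠ e       ≡⟨ cong (_*ᶠ e) (⁻¹-inverse k k≢0) ⟩
    1ᶠ *ᶠ e                ≡⟨ *-identityˡ e ⟩
    e                      ∎

  zero-divisor : ∀ {k t} → k ≢ 0ᶠ → k *ᶠ t ≡ 0ᶠ → t ≡ 0ᶠ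
  zero-divisor k≢0 kt≡0 = trans (linear-unique k≢0 kt≡0) (zeroˡ _)

  δ-scale : ∀ {k} t e → k ≢ 0ᶠ → δ F (k *ᶠ t) e ≡ δ F t (e *ᶠ k ⁻¹)
  δ-scale t e k≢0 = δ-iff (linear-unique k≢0) (λ t≡ → trans (cong _ t≡) (linear-solution e k≢0))

  Σ-δ-linear : ∀ {k} e → k ≢ 0ᶠ → Σ[ F ] (λ t → δ F (k *ᶠ t) e) ≡ + 1
  Σ-δ-linear e k≢0 = trans (Σ-cong (λ t → δ-scale t e k≢0)) (Σ-δ _)

  affine-self : ∀ u v → u *ᶠ (v -ᶠ v) ≡ 0ᶠ
  affine-self = solve 2 (λ u v → u :* (v :- v) := con (+ 0)) refl

  δ-affine-zero : ∀ {u} y v → u ≢ 0ᶠ → δ F (u *ᶠ (y -ᶠ v)) 0ᶠ ≡ δ F y v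
  δ-affine-zero {u} y v u≢0 =
    δ-iff (diff≡0⇒≡ ∘ zero-divisor u≢0) (λ { refl → affine-self u y })

  affine-nonzero : ∀ {u y v} → u ≢ 0ᶠ → y ≢ v → u *ᶠ (y -ᶠ v) ≢ 0ᶠ
  affine-nonzero u≢0 y≢v = y≢v ∘ diff≡0⇒≡ ∘ zero-divisor u≢0

  affine-opposite : ∀ u v y → (-ᶠ u) *ᶠ (v -ᶠ y) ≡ u *ᶠ (y -ᶠ v)
  affine-opposite = solve 3 (λ u v y → (:- u) :* (v :- y) := u :* (y :- v)) refl

  affine-swap : ∀ u y v → u *ᶠ (y -ᶠ v) ≡ (y -ᶠ v) *ᶠ (u -ᶠ 0ᶠ)
  affine-swap = solve 3 (λ u y v → u :* (y :- v) := (y :- v) :* (u :- con (+ 0))) refl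

  Σ-δ-affine : ∀ {u} v x → u ≢ 0ᶠ → Σ[ F ] (λ y → δ F (u *ᶠ (y -ᶠ v)) x) ≡ + 1
  Σ-δ-affine {u} v x u≢0 = trans (Σ-cong (λ y → δ-sub (expand y))) (Σ-δ-linear (x +ᶠ u *ᶠ v) u≢0)
    where
    expand : ∀ y → (u *ᶠ (y -ᶠ v)) -ᶠ x ≡ (u *ᶠ y) -ᶠ (x +ᶠ u *ᶠ v)
    expand y = solve 4 (λ u v x y → u :* (y :- v) :- x := u :* y :- (x :+ u :* v)) refl u v x y

  -- the two affine maps y ↦ u·(y - v) and y ↦ u'·(v' - y) agree at exactly
  -- one point when u + u' ≠ 0
  meeting-point : Carrier → Carrier → Carrier → Carrier → Carrier
  meeting-point u u' v v' = (u *ᶠ v +ᶠ u' *ᶠ v') *ᶠ (u +ᶠ u') ⁻¹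

  δ-meeting : ∀ {u u'} y v v' → (u +ᶠ u') ≢ 0ᶠ →
    δ F (u *ᶠ (y -ᶠ v)) (u' *ᶠ (v' -ᶠ y)) ≡ δ F y (meeting-point u u' v v')
  δ-meeting {u} {u'} y v v' s≢0 =
    trans (δ-sub (solve 5 (λ u u' v v' y → u :* (y :- v) :- u' :* (v' :- y)
                              := (u :+ u') :* y :- (u :* v :+ u' :* v')) refl u u' v v' y))
          (δ-scale y _ s≢0)

  meeting-value : ∀ {u u'} v v' → (u +ᶠ u') ≢ 0ᶠ →
    u *ᶠ (meeting-point u u' v v' -ᶠ v) ≡ ((u *ᶠ u') *ᶠ (u +ᶠ u') ⁻¹) *ᶠ (v' -ᶠ v)
  meeting-value {u} {u'} v v' s≢0 = begin
    u *ᶠ (meeting-point u u' v v' -ᶠ v)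
      ≡⟨ solve 5 (λ u u' v v' w → u :* ((u :* v :+ u' :* v') :* w :- v)
                   := (u :* u' :* w :* (v' :- v) :+ (u :* v) :* ((u :+ u') :* w)) :- u :* v)
               refl u u' v v' w ⟩
    (X +ᶠ (u *ᶠ v) *ᶠ ((u +ᶠ u') *ᶠ w)) -ᶠ (u *ᶠ v)
      ≡⟨ cong (λ z → (X +ᶠ (u *ᶠ v) *ᶠ z) -ᶠ (u *ᶠ v)) (⁻¹-inverse _ s≢0) ⟩
    (X +ᶠ (u *ᶠ v) *ᶠ 1ᶠ) -ᶠ (u *ᶠ v)
      ≡⟨ cong (λ z → (X +ᶠ z) -ᶠ (u *ᶠ v)) (trans (*-comm _ 1ᶠ) (*-identityˡ _)) ⟩
    (X +ᶠ u *ᶠ v) -ᶠ (u *ᶠ v)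
      ≡⟨ solve 2 (λ X y → (X :+ y) :- y := X) refl X (u *ᶠ v) ⟩
    X ∎
    where
    w X : Carrier
    w = (u +ᶠ u') ⁻¹
    X = ((u *ᶠ u') *ᶠ w) *ᶠ (v' -ᶠ v)

  meeting-diagonal : ∀ {u u'} v → (u +ᶠ u') ≢ 0ᶠ → meeting-point u u' v v ≡ v
  meeting-diagonal {u} {u'} v s≢0 = begin
    (u *ᶠ v +ᶠ u' *ᶠ v) *ᶠ (u +ᶠ u') ⁻¹   ≡⟨ cong (_*ᶠ (u +ᶠ u') ⁻¹)
                                               (solve 3 (λ u u' v → u :* v :+ u' :* v := v :* (u :+ u')) refl u u' v) ⟩
    v *ᶠ (u +ᶠ u') *ᶠ (u +ᶠ u') ⁻¹        ≡⟨ solve 3 (λ v s w → v :* s :* w := v :* (s :* w)) refl v _ _ ⟩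
    v *ᶠ ((u +ᶠ u') *ᶠ (u +ᶠ u') ⁻¹)      ≡⟨ cong (v *ᶠ_) (⁻¹-inverse _ s≢0) ⟩
    v *ᶠ 1ᶠ                               ≡⟨ trans (*-comm v 1ᶠ) (*-identityˡ v) ⟩
    v                                     ∎

  δ-opposite : ∀ {u} y v v' → u ≢ 0ᶠ → δ F (u *ᶠ (y -ᶠ v)) ((-ᶠ u) *ᶠ (v' -ᶠ y)) ≡ δ F v' v
  δ-opposite {u} y v v' u≢0 =
    trans (δ-sub (solve 4 (λ u v v' y → u :* (y :- v) :- (:- u) :* (v' :- y) := u :* (v' :- v) :- con (+ 0))
                   refl u v v' y))
          (δ-affine-zero v' v u≢0)

module AffinePlane {q : ℕ} (F : FiniteField q) where
  open FiniteField F
  open FieldFacts F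
  open IsCommutativeRing isCommutativeRing using (*-comm)
  open ≡-Reasoning

  Point : Set
  Point = Carrier × Carrier

  onLine : Carrier → Point → Point → ℤ
  onLine c (a₁ , a₂) (a₁' , a₂') = δ F (a₂' -ᶠ a₂) (c *ᶠ (a₁' -ᶠ a₁))

  incidence : Maybe Carrier → Point → Point → ℤ
  incidence nothing  p p' = + 0
  incidence (just c) p p' = onLine c p p'

  -- a sum over the plane, in the order used by the matrix product
  Σ² : (Point → ℤ) → ℤ
  Σ² f = Σ[ F ] λ t → Σ[ F ] λ s → f (t , s)

  paths : Maybe Carrier → Maybe Carrier → Point → Point → ℤ
  paths m m' p p'' = Σ² λ r → incidence m p r * incidence m' r p''

  onLine-sym : ∀ c p p' → onLine c p p' ≡ onLine c p' p
  onLine-sym c (a₁ , a₂) (a₁' , a₂') = begin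
    δ F (a₂' -ᶠ a₂) (c *ᶠ (a₁' -ᶠ a₁))                   ≡⟨ δ-diff _ _ ⟩
    δ F ((a₂' -ᶠ a₂) -ᶠ (c *ᶠ (a₁' -ᶠ a₁))) 0ᶠ           ≡⟨ cong (λ d → δ F d 0ᶠ) (solve 5 (λ c a₁ a₂ a₁' a₂' →
                                                               (a₂' :- a₂) :- c :* (a₁' :- a₁)
                                                               := :- ((a₂ :- a₂') :- c :* (a₁ :- a₁'))) refl c a₁ a₂ a₁' a₂') ⟩
    δ F (-ᶠ ((a₂ -ᶠ a₂') -ᶠ (c *ᶠ (a₁ -ᶠ a₁')))) 0ᶠ      ≡⟨ δ-neg _ ⟩
    δ F ((a₂ -ᶠ a₂') -ᶠ (c *ᶠ (a₁ -ᶠ a₁'))) 0ᶠ           ≡⟨ δ-diff _ _ ⟨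
    δ F (a₂ -ᶠ a₂') (c *ᶠ (a₁ -ᶠ a₁'))                   ∎

  incidence-sym : ∀ m p p' → incidence m p p' ≡ incidence m p' p
  incidence-sym nothing  p p' = refl
  incidence-sym (just c) p p' = onLine-sym c p p'

  onLine-column : ∀ c p t → Σ[ F ] (λ s → onLine c p (t , s)) ≡ + 1
  onLine-column c (a₁ , a₂) t = trans (Σ-cong (λ s → δ-sub (shift s))) (Σ-δ (a₂ +ᶠ c *ᶠ (t -ᶠ a₁)))
    where
    shift : ∀ s → (s -ᶠ a₂) -ᶠ (c *ᶠ (t -ᶠ a₁)) ≡ s -ᶠ (a₂ +ᶠ c *ᶠ (t -ᶠ a₁))
    shift s = solve 5 (λ c a₁ a₂ t s → (s :- a₂) :- c :* (t :- a₁) := s :- (a₂ :+ c :* (t :- a₁)))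
                refl c a₁ a₂ t s

  onLine-vertical : ∀ c a₁ a₂ a₂'' → onLine c (a₁ , a₂) (a₁ , a₂'') ≡ δ F a₂ a₂''
  onLine-vertical c a₁ a₂ a₂'' =
    trans (δ-sub (solve 4 (λ c a₁ a₂ a₂'' → (a₂'' :- a₂) :- c :* (a₁ :- a₁) := a₂'' :- a₂)
                   refl c a₁ a₂ a₂''))
          (δ-sym a₂'' a₂)

  slope : Point → Point → Carrier
  slope (a₁ , a₂) (a₁'' , a₂'') = (a₂'' -ᶠ a₂) *ᶠ (a₁'' -ᶠ a₁) ⁻¹

  onLine-slope : ∀ c a₁ a₂ a₁'' a₂'' → a₁ ≢ a₁'' →
    onLine c (a₁ , a₂) (a₁'' , a₂'') ≡ δ F c (slope (a₁ , a₂) (a₁'' , a₂''))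
  onLine-slope c a₁ a₂ a₁'' a₂'' a₁≢a₁'' = begin
    δ F (a₂'' -ᶠ a₂) (c *ᶠ d)   ≡⟨ δ-sym _ _ ⟩
    δ F (c *ᶠ d) (a₂'' -ᶠ a₂)   ≡⟨ cong (λ x → δ F x (a₂'' -ᶠ a₂)) (*-comm c d) ⟩
    δ F (d *ᶠ c) (a₂'' -ᶠ a₂)   ≡⟨ δ-scale c (a₂'' -ᶠ a₂) d≢0 ⟩
    δ F c ((a₂'' -ᶠ a₂) *ᶠ d ⁻¹) ∎
    where
    d : Carrier
    d = a₁'' -ᶠ a₁
    d≢0 : d ≢ 0ᶠ
    d≢0 = a₁≢a₁'' ∘ sym ∘ diff≡0⇒≡

  -- along lines of slopes c₁, c₂ the intermediate point r is determined by
  -- its abscissa t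
  paths-just : ∀ c₁ c₂ a₁ a₂ a₁'' a₂'' → paths (just c₁) (just c₂) (a₁ , a₂) (a₁'' , a₂'')
    ≡ Σ[ F ] (λ t → δ F (a₂'' -ᶠ (a₂ +ᶠ c₁ *ᶠ (t -ᶠ a₁))) (c₂ *ᶠ (a₁'' -ᶠ t)))
  paths-just c₁ c₂ a₁ a₂ a₁'' a₂'' = Σ-cong λ t → begin
    Σ[ F ] (λ s → δ F (s -ᶠ a₂) (X t) * δ F (a₂'' -ᶠ s) (Y t))
      ≡⟨ Σ-cong (λ s → cong (_* δ F (a₂'' -ᶠ s) (Y t)) (δ-sub (shift t s))) ⟩
    Σ[ F ] (λ s → δ F s (a₂ +ᶠ X t) * δ F (a₂'' -ᶠ s) (Y t))
      ≡⟨ Σ-δ* (a₂ +ᶠ X t) (λ s → δ F (a₂'' -ᶠ s) (Y t)) ⟩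
    δ F (a₂'' -ᶠ (a₂ +ᶠ X t)) (Y t) ∎
    where
    X Y : Carrier → Carrier
    X t = c₁ *ᶠ (t -ᶠ a₁)
    Y t = c₂ *ᶠ (a₁'' -ᶠ t)
    shift : ∀ t s → (s -ᶠ a₂) -ᶠ X t ≡ s -ᶠ (a₂ +ᶠ X t)
    shift t s = solve 3 (λ s a₂ x → (s :- a₂) :- x := s :- (a₂ :+ x)) refl s a₂ (X t)

  -- along one slope the path exists for every t as soon as p'' is on the line
  paths-same : ∀ c p p'' → paths (just c) (just c) p p'' ≡ + q * onLine c p p''
  paths-same c (a₁ , a₂) (a₁'' , a₂'') = begin
    paths (just c) (just c) (a₁ , a₂) (a₁'' , a₂'')
      ≡⟨ paths-just c c a₁ a₂ a₁'' a₂'' ⟩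
    Σ[ F ] (λ t → δ F (a₂'' -ᶠ (a₂ +ᶠ c *ᶠ (t -ᶠ a₁))) (c *ᶠ (a₁'' -ᶠ t)))
      ≡⟨ Σ-cong (λ t → δ-sub (solve 6 (λ c a₁ a₂ a₁'' a₂'' t →
            (a₂'' :- (a₂ :+ c :* (t :- a₁))) :- c :* (a₁'' :- t) := (a₂'' :- a₂) :- c :* (a₁'' :- a₁))
            refl c a₁ a₂ a₁'' a₂'' t)) ⟩
    Σ[ F ] (λ t → onLine c (a₁ , a₂) (a₁'' , a₂''))
      ≡⟨ Σ-const _ ⟩
    + q * onLine c (a₁ , a₂) (a₁'' , a₂'') ∎

  paths-distinct : ∀ c₁ c₂ p p'' → c₁ ≢ c₂ → paths (just c₁) (just c₂) p p'' ≡ + 1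
  paths-distinct c₁ c₂ (a₁ , a₂) (a₁'' , a₂'') c₁≢c₂ = begin
    paths (just c₁) (just c₂) (a₁ , a₂) (a₁'' , a₂'')
      ≡⟨ paths-just c₁ c₂ a₁ a₂ a₁'' a₂'' ⟩
    Σ[ F ] (λ t → δ F (a₂'' -ᶠ (a₂ +ᶠ c₁ *ᶠ (t -ᶠ a₁))) (c₂ *ᶠ (a₁'' -ᶠ t)))
      ≡⟨ Σ-cong (λ t → trans (δ-sub (linear t)) (δ-sym e (k *ᶠ t))) ⟩
    Σ[ F ] (λ t → δ F (k *ᶠ t) e)
      ≡⟨ Σ-δ-linear e (c₁≢c₂ ∘ diff≡0⇒≡) ⟩
    + 1 ∎
    where
    k e : Carrier
    k = c₁ -ᶠ c₂
    e = ((a₂'' -ᶠ a₂) +ᶠ c₁ *ᶠ a₁) -ᶠ (c₂ *ᶠ a₁'')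
    linear : ∀ t → (a₂'' -ᶠ (a₂ +ᶠ c₁ *ᶠ (t -ᶠ a₁))) -ᶠ (c₂ *ᶠ (a₁'' -ᶠ t)) ≡ e -ᶠ (k *ᶠ t)
    linear t = solve 7 (λ c₁ c₂ a₁ a₂ a₁'' a₂'' t →
                 (a₂'' :- (a₂ :+ c₁ :* (t :- a₁))) :- c₂ :* (a₁'' :- t)
                 := (((a₂'' :- a₂) :+ c₁ :* a₁) :- c₂ :* a₁'') :- (c₁ :- c₂) :* t)
                 refl c₁ c₂ a₁ a₂ a₁'' a₂'' t

  paths-nothingˡ : ∀ m p p'' → paths nothing m p p'' ≡ + 0
  paths-nothingˡ m p p'' = Σ-zero _ (λ t → Σ-zero _ (λ s → refl))

  paths-nothingʳ : ∀ m p p'' → paths m nothing p p'' ≡ + 0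
  paths-nothingʳ m p p'' = Σ-zero _ (λ t → Σ-zero _ (λ s → ℤP.*-zeroʳ (incidence m p (t , s))))

  paths-self : ∀ m p p'' → paths m m p p'' ≡ + q * incidence m p p''
  paths-self nothing  p p'' = trans (paths-nothingˡ nothing p p'') (sym (ℤP.*-zeroʳ (+ q)))
  paths-self (just c) p p'' = paths-same c p p''

module MatrixIdentities {q : ℕ} (F : FiniteField q) (K : FiniteField (suc q))
  (φ : FiniteField.Carrier K → Maybe (FiniteField.Carrier F))
  (φ-bijective : Bijective _≡_ _≡_ φ) (φ-0 : φ (FiniteField.0ᶠ K) ≡ nothing) where

  open Setting F K φ
  open AffinePlane F
  module FF = FieldFacts F
  module KF = FieldFacts K
  open FiniteField F using () renaming (Carrier to 𝔽; _*ᶠ_ to _*F_; _-ᶠ_ to _-F_; _≟_ to _≟F_)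
  open FiniteField K using () renaming (Carrier to 𝕂; _*ᶠ_ to _*K_; _-ᶠ_ to _-K_; _≟_ to _≟K_)
  open ≡-Reasoning

  φ-injective : ∀ {x y} → φ x ≡ φ y → x ≡ y
  φ-injective = proj₁ φ-bijective

  φ⁻¹ : Maybe 𝔽 → 𝕂
  φ⁻¹ m = proj₁ (proj₂ φ-bijective m)

  φ-φ⁻¹ : ∀ m → φ (φ⁻¹ m) ≡ m
  φ-φ⁻¹ m = proj₂ (proj₂ φ-bijective m) refl

  φ-zero : ∀ {x} → x ≡ 0K → φ x ≡ nothing
  φ-zero refl = φ-0

  φ-nonzero : ∀ {x} → x ≢ 0K → ∃ λ c → φ x ≡ just c
  φ-nonzero {x} x≢0 with φ x in e
  ... | just c  = c , refl
  ... | nothing = ⊥-elim (x≢0 (φ-injective (trans e (sym φ-0))))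

  δ-φ : ∀ {x y c c'} → φ x ≡ just c → φ y ≡ just c' → δ F c c' ≡ δ K x y
  δ-φ {x} {y} {c} {c'} e e' with c ≟F c'
  ... | yes c≡c' = sym (KF.δ-yes (φ-injective (trans e (trans (cong just c≡c') (sym e')))))
  ... | no  c≢c' = sym (KF.δ-no (λ x≡y → c≢c' (just-injective (trans (sym e) (trans (cong φ x≡y) e')))))
    where
    just-injective : ∀ {c c' : 𝔽} → just c ≡ just c' → c ≡ c'
    just-injective refl = refl

  N-entry : ∀ β b p b' p' → N β (b , p) (b' , p') ≡ incidence (φ (β *K (b' -K b))) p p'
  N-entry β b (a₁ , a₂) b' (a₁' , a₂') with φ (β *K (b' -K b))
  ... | nothing = refl
  ... | just c with (a₂' -F a₂) ≟F (c *F (a₁' -F a₁))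
  ...   | yes _ = refl
  ...   | no  _ = refl

  diagonal-slope : ∀ u b → φ (u *K (b -K b)) ≡ nothing
  diagonal-slope u b = φ-zero (KF.affine-self u b)

  -- (i): N_β^T = N_{-β}, since β(b - b') = (-β)(b' - b) and incidence is symmetric
  part-i : ∀ β → transpose (N β) ≋ N (negK β)
  part-i β (b , p) (b' , p') = begin
    N β (b' , p') (b , p)                          ≡⟨ N-entry β b' p' b p ⟩
    incidence (φ (β *K (b -K b'))) p' p            ≡⟨ cong (λ x → incidence (φ x) p' p) (KF.affine-opposite β b' b) ⟨
    incidence (φ (negK β *K (b' -K b))) p' p       ≡⟨ incidence-sym (φ (negK β *K (b' -K b))) p' p ⟩
    incidence (φ (negK β *K (b' -K b))) p p'       ≡⟨ N-entry (negK β) b p b' p' ⟨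
    N (negK β) (b , p) (b' , p')                   ∎

  incidence-vertical : ∀ x a₁ a₂ a₂'' →
    incidence (φ x) (a₁ , a₂) (a₁ , a₂'') ≡ δ F a₂ a₂'' - δ K x 0K * δ F a₂ a₂''
  incidence-vertical x a₁ a₂ a₂'' with x ≟K 0K
  ... | yes x≡0 = trans (cong (λ m → incidence m (a₁ , a₂) (a₁ , a₂'')) (φ-zero x≡0))
                        (sym (trans (cong (λ e → δ F a₂ a₂'' - e) (ℤP.*-identityˡ _)) (ℤP.+-inverseʳ (δ F a₂ a₂''))))
  ... | no x≢0 with φ-nonzero x≢0
  ...   | c , e = trans (cong (λ m → incidence m (a₁ , a₂) (a₁ , a₂'')) e)
                        (trans (onLine-vertical c a₁ a₂ a₂'') (sym (ℤP.+-identityʳ _)))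

  incidence-slope : ∀ x a₁ a₂ a₁'' a₂'' → a₁ ≢ a₁'' →
    incidence (φ x) (a₁ , a₂) (a₁'' , a₂'') ≡ δ K x (φ⁻¹ (just (slope (a₁ , a₂) (a₁'' , a₂''))))
  incidence-slope x a₁ a₂ a₁'' a₂'' a₁≢a₁'' with φ x in e
  ... | nothing = sym (KF.δ-no λ { refl → nothing≢just (trans (sym e) (φ-φ⁻¹ _)) })
    where
    nothing≢just : ∀ {c : 𝔽} → nothing ≢ just c
    nothing≢just ()
  ... | just c  = trans (onLine-slope c a₁ a₂ a₁'' a₂'' a₁≢a₁'') (δ-φ e (φ-φ⁻¹ _))

  -- as y runs over K, the slopes φ(u(y - v)) run over F ∪ {x} once each; so p''
  -- is reached once from p when it is off the vertical through p, q times
  -- when p'' = p, and never otherwise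
  pencilCount : Point → Point → ℤ
  pencilCount (a₁ , a₂) (a₁'' , a₂'') = + q * (δ F a₁ a₁'' * δ F a₂ a₂'') + (+ 1 - δ F a₁ a₁'')

  pencil : ∀ {u} v p p'' → u ≢ 0K → Σ[ K ] (λ y → incidence (φ (u *K (y -K v))) p p'') ≡ pencilCount p p''
  pencil {u} v (a₁ , a₂) (a₁'' , a₂'') u≢0 with a₁ ≟F a₁''
  ... | yes refl = begin
    Σ[ K ] (λ y → incidence (φ (u *K (y -K v))) (a₁ , a₂) (a₁ , a₂''))
      ≡⟨ KF.Σ-cong (λ y → trans (incidence-vertical _ a₁ a₂ a₂'')
                                (cong (λ e → d - e * d) (KF.δ-affine-zero y v u≢0))) ⟩
    Σ[ K ] (λ y → d - δ K y v * d)
      ≡⟨ KF.Σ-- (λ _ → d) (λ y → δ K y v * d) ⟩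
    Σ[ K ] (λ _ → d) - Σ[ K ] (λ y → δ K y v * d)
      ≡⟨ cong₂ _-_ (KF.Σ-const d) (KF.Σ-δ* v (λ _ → d)) ⟩
    + suc q * d - d
      ≡⟨ count (+ q) d ⟩
    + q * (+ 1 * d) + (+ 1 - + 1) ∎
    where
    d : ℤ
    d = δ F a₂ a₂''
    count : ∀ Q d → (+ 1 + Q) * d - d ≡ Q * (+ 1 * d) + (+ 1 - + 1)
    count = solve-∀
  ... | no a₁≢a₁'' = begin
    Σ[ K ] (λ y → incidence (φ (u *K (y -K v))) (a₁ , a₂) (a₁'' , a₂''))
      ≡⟨ KF.Σ-cong (λ y → incidence-slope _ a₁ a₂ a₁'' a₂'' a₁≢a₁'') ⟩
    Σ[ K ] (λ y → δ K (u *K (y -K v)) _)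
      ≡⟨ KF.Σ-δ-affine v _ u≢0 ⟩
    + 1
      ≡⟨ count (+ q) (δ F a₂ a₂'') ⟩
    + q * (+ 0 * δ F a₂ a₂'') + (+ 1 - + 0) ∎
    where
    count : ∀ Q d → + 1 ≡ Q * (+ 0 * d) + (+ 1 - + 0)
    count = solve-∀

  -- (vi): Σ_{β ≠ 0} N_β = (J - I) ⊗ (q I + (J - I) ⊗ J).  Off the diagonal
  -- blocks, the slopes φ(β(b' - b)) run over F ∪ {x} as β runs over K
  part-vi : ΣK* N ≋ rhs-vi
  part-vi (b , a₁ , a₂) (b' , a₁' , a₂') with b ≟K b'
  ... | yes refl = KF.Σ-zero _ (λ β → trans
        (cong (λ n → (+ 1 - δ K β 0K) * n)
              (trans (N-entry β b (a₁ , a₂) b (a₁' , a₂'))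
                     (cong (λ m → incidence m (a₁ , a₂) (a₁' , a₂')) (diagonal-slope β b))))
        (ℤP.*-zeroʳ (+ 1 - δ K β 0K)))
  ... | no b≢b' = begin
    Σ[ K ] (λ β → (+ 1 - δ K β 0K) * N β (b , p) (b' , p'))
      ≡⟨ KF.Σ-cong weighted-entry ⟩
    Σ[ K ] (λ β → incidence (φ ((b' -K b) *K (β -K 0K))) p p')
      ≡⟨ pencil 0K p p' (b≢b' ∘ sym ∘ KF.diff≡0⇒≡) ⟩
    pencilCount p p'
      ≡⟨ arithmetic (+ q) (δ F a₁ a₁') (δ F a₂ a₂') ⟩
    (+ 1 - + 0) * (+ q * (δ F a₁ a₁' * δ F a₂ a₂') + (+ 1 - δ F a₁ a₁') * + 1) ∎
    where
    p p' : Point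
    p = (a₁ , a₂)
    p' = (a₁' , a₂')
    weighted-entry : ∀ β → (+ 1 - δ K β 0K) * N β (b , p) (b' , p') ≡ incidence (φ ((b' -K b) *K (β -K 0K))) p p'
    weighted-entry β with β ≟K 0K
    ... | yes refl = sym (cong (λ m → incidence m p p') (φ-zero (KF.affine-self (b' -K b) 0K)))
    ... | no _     = trans (ℤP.*-identityˡ _)
                    (trans (N-entry β b p b' p') (cong (λ x → incidence (φ x) p p') (KF.affine-swap β b' b)))
    arithmetic : ∀ Q d₁ d₂ → Q * (d₁ * d₂) + (+ 1 - d₁) ≡ (+ 1 - + 0) * (Q * (d₁ * d₂) + (+ 1 - d₁) * + 1)
    arithmetic = solve-∀

  incidence-column : ∀ x p t → Σ[ F ] (λ s → incidence (φ x) p (t , s)) ≡ + 1 - δ K x 0K * + 1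
  incidence-column x p t with x ≟K 0K
  ... | yes x≡0 = FF.Σ-zero _ (λ s → cong (λ m → incidence m p (t , s)) (φ-zero x≡0))
  ... | no  x≢0 with φ-nonzero x≢0
  ...   | c , e = trans (FF.Σ-cong (λ s → cong (λ m → incidence m p (t , s)) e)) (onLine-column c p t)

  incidence-column-affine : ∀ {β} b b'' p t → β ≢ 0K →
    Σ[ F ] (λ s → incidence (φ (β *K (b'' -K b))) p (t , s)) ≡ + 1 - δ K b b'' * + 1
  incidence-column-affine {β} b b'' p t β≢0 =
    trans (incidence-column _ p t)
          (cong (λ e → + 1 - e * + 1) (trans (KF.δ-affine-zero b'' b β≢0) (KF.δ-sym b'' b)))

  N-row : ∀ {β} b p b'' t → β ≢ 0K → Σ[ F ] (λ s → N β (b , p) (b'' , t , s)) ≡ + 1 - δ K b b'' * + 1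
  N-row {β} b p b'' t β≢0 =
    trans (FF.Σ-cong (λ s → N-entry β b p b'' (t , s))) (incidence-column-affine b b'' p t β≢0)

  -- by the symmetry of incidence, the same holds for the columns
  N-column : ∀ {β} b t b'' p'' → β ≢ 0K → Σ[ F ] (λ s → N β (b , t , s) (b'' , p'')) ≡ + 1 - δ K b b'' * + 1
  N-column {β} b t b'' p'' β≢0 =
    trans (FF.Σ-cong (λ s → trans (N-entry β b (t , s) b'' p'') (incidence-sym (φ (β *K (b'' -K b))) (t , s) p'')))
          (incidence-column-affine b b'' p'' t β≢0)

  BlockDiagonal : (Point → Point → ℤ) → Mat → Set
  BlockDiagonal W B = ∀ b r b' r' → B (b , r) (b' , r') ≡ δ K b b' * W r r'

  ·-blockDiagonal : ∀ A {B} W → BlockDiagonal W B →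
    ∀ i b'' r'' → (A · B) i (b'' , r'') ≡ Σ² (λ r → A i (b'' , r) * W r r'')
  ·-blockDiagonal A {B} W B-blocks i b'' r'' = begin
    Σ[ K ] (λ b' → Σ² (λ r → A i (b' , r) * B (b' , r) (b'' , r'')))
      ≡⟨ KF.Σ-cong (λ b' → FF.Σ-cong (λ t → FF.Σ-cong (λ s →
           trans (cong (A i (b' , t , s) *_) (B-blocks b' (t , s) b'' r''))
                 (reorder (A i (b' , t , s)) (δ K b' b'') (W (t , s) r''))))) ⟩
    Σ[ K ] (λ b' → Σ² (λ r → A i (b' , r) * W r r'' * δ K b' b''))
      ≡⟨ KF.Σ-cong (λ b' → trans (FF.Σ-cong (λ t → FF.Σ-*ʳ (λ s → A i (b' , t , s) * W (t , s) r'') (δ K b' b'')))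
                                 (FF.Σ-*ʳ (λ t → Σ[ F ] (λ s → A i (b' , t , s) * W (t , s) r'')) (δ K b' b''))) ⟩
    Σ[ K ] (λ b' → Σ² (λ r → A i (b' , r) * W r r'') * δ K b' b'')
      ≡⟨ KF.Σ-*δ b'' (λ b' → Σ² (λ r → A i (b' , r) * W r r'')) ⟩
    Σ² (λ r → A i (b'' , r) * W r r'') ∎
    where
    reorder : ∀ a d w → a * (d * w) ≡ a * w * d
    reorder = solve-∀

  blockDiagonal-· : ∀ A {B} W → BlockDiagonal W B →
    ∀ b r j → (B · A) (b , r) j ≡ Σ² (λ r' → W r r' * A (b , r') j)
  blockDiagonal-· A {B} W B-blocks b r j = begin
    Σ[ K ] (λ b' → Σ² (λ r' → B (b , r) (b' , r') * A (b' , r') j))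
      ≡⟨ KF.Σ-cong (λ b' → FF.Σ-cong (λ t → FF.Σ-cong (λ s →
           trans (cong (_* A (b' , t , s) j) (trans (B-blocks b r b' (t , s))
                                                   (cong (_* W r (t , s)) (KF.δ-sym b b'))))
                 (reorder (δ K b' b) (W r (t , s)) (A (b' , t , s) j))))) ⟩
    Σ[ K ] (λ b' → Σ² (λ r' → W r r' * A (b' , r') j * δ K b' b))
      ≡⟨ KF.Σ-cong (λ b' → trans (FF.Σ-cong (λ t → FF.Σ-*ʳ (λ s → W r (t , s) * A (b' , t , s) j) (δ K b' b)))
                                 (FF.Σ-*ʳ (λ t → Σ[ F ] (λ s → W r (t , s) * A (b' , t , s) j)) (δ K b' b))) ⟩
    Σ[ K ] (λ b' → Σ² (λ r' → W r r' * A (b' , r') j) * δ K b' b)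
      ≡⟨ KF.Σ-*δ b (λ b' → Σ² (λ r' → W r r' * A (b' , r') j)) ⟩
    Σ² (λ r' → W r r' * A (b , r') j) ∎
    where
    reorder : ∀ d w a → d * w * a ≡ w * a * d
    reorder = solve-∀

  sameColumn allOnes : Point → Point → ℤ
  sameColumn r r' = δ F (proj₁ r) (proj₁ r') * + 1
  allOnes    r r' = + 1

  I⊗Jq-blocks : BlockDiagonal sameColumn I⊗Jq
  I⊗Jq-blocks b (t , s) b' (t' , s') = ℤP.*-assoc (δ K b b') (δ F t t') (+ 1)

  I⊗Jq²-blocks : BlockDiagonal allOnes I⊗Jq²
  I⊗Jq²-blocks b r b' r' = refl

  Σ²-sameColumnʳ : ∀ (g : Point → ℤ) r'' → Σ² (λ r → g r * sameColumn r r'') ≡ Σ[ F ] (λ s → g (proj₁ r'' , s))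
  Σ²-sameColumnʳ g (t'' , _) = begin
    Σ² (λ r → g r * (δ F (proj₁ r) t'' * + 1))
      ≡⟨ FF.Σ-cong (λ t → trans (FF.Σ-cong (λ s → reorder (g (t , s)) (δ F t t'')))
                                (FF.Σ-*ʳ (λ s → g (t , s)) (δ F t t''))) ⟩
    Σ[ F ] (λ t → Σ[ F ] (λ s → g (t , s)) * δ F t t'')
      ≡⟨ FF.Σ-*δ t'' (λ t → Σ[ F ] (λ s → g (t , s))) ⟩
    Σ[ F ] (λ s → g (t'' , s)) ∎
    where
    reorder : ∀ a d → a * (d * + 1) ≡ a * d
    reorder = solve-∀

  Σ²-sameColumnˡ : ∀ r (g : Point → ℤ) → Σ² (λ r' → sameColumn r r' * g r') ≡ Σ[ F ] (λ s → g (proj₁ r , s))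
  Σ²-sameColumnˡ (t , s) g =
    trans (FF.Σ-cong (λ t' → FF.Σ-cong (λ s' → trans (ℤP.*-comm (sameColumn (t , s) (t' , s')) (g (t' , s')))
                                                     (cong (λ e → g (t' , s') * (e * + 1)) (FF.δ-sym t t')))))
          (Σ²-sameColumnʳ g (t , s))

  Σ²-allOnes : ∀ (g : Point → ℤ) → Σ² (λ r → g r * + 1) ≡ Σ² g
  Σ²-allOnes g = FF.Σ-cong (λ t → FF.Σ-cong (λ s → ℤP.*-identityʳ (g (t , s))))

  Σ²-allOnesˡ : ∀ (g : Point → ℤ) → Σ² (λ r → + 1 * g r) ≡ Σ² g
  Σ²-allOnesˡ g = FF.Σ-cong (λ t → FF.Σ-cong (λ s → ℤP.*-identityˡ (g (t , s))))

  part-iv : ∀ {β} → β ≢ 0K → ((N β · I⊗Jq) ≋ (Jₘ ⊖ I⊗Jq²)) × ((I⊗Jq · N β) ≋ (Jₘ ⊖ I⊗Jq²))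
  part-iv {β} β≢0 = right , left
    where
    right : (N β · I⊗Jq) ≋ (Jₘ ⊖ I⊗Jq²)
    right (b , a₁ , a₂) (b'' , r'') =
      trans (·-blockDiagonal (N β) sameColumn I⊗Jq-blocks (b , a₁ , a₂) b'' r'')
     (trans (Σ²-sameColumnʳ (λ r → N β (b , a₁ , a₂) (b'' , r)) r'')
            (N-row b (a₁ , a₂) b'' (proj₁ r'') β≢0))
    left : (I⊗Jq · N β) ≋ (Jₘ ⊖ I⊗Jq²)
    left (b , r) (b'' , a₁'' , a₂'') =
      trans (blockDiagonal-· (N β) sameColumn I⊗Jq-blocks b r (b'' , a₁'' , a₂''))
     (trans (Σ²-sameColumnˡ r (λ r' → N β (b , r') (b'' , a₁'' , a₂'')))
            (N-column b (proj₁ r) b'' (a₁'' , a₂'') β≢0))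

  part-v : ∀ {β} → β ≢ 0K →
    ((N β · I⊗Jq²) ≋ ((+ q) ⊙ (Jₘ ⊖ I⊗Jq²))) × ((I⊗Jq² · N β) ≋ ((+ q) ⊙ (Jₘ ⊖ I⊗Jq²)))
  part-v {β} β≢0 = right , left
    where
    right : (N β · I⊗Jq²) ≋ ((+ q) ⊙ (Jₘ ⊖ I⊗Jq²))
    right (b , a₁ , a₂) (b'' , r'') = begin
      (N β · I⊗Jq²) (b , a₁ , a₂) (b'' , r'')
        ≡⟨ ·-blockDiagonal (N β) allOnes I⊗Jq²-blocks (b , a₁ , a₂) b'' r'' ⟩
      Σ² (λ r → N β (b , a₁ , a₂) (b'' , r) * + 1)
        ≡⟨ Σ²-allOnes (λ r → N β (b , a₁ , a₂) (b'' , r)) ⟩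
      Σ[ F ] (λ t → Σ[ F ] (λ s → N β (b , a₁ , a₂) (b'' , t , s)))
        ≡⟨ FF.Σ-cong (λ t → N-row b (a₁ , a₂) b'' t β≢0) ⟩
      Σ[ F ] (λ t → + 1 - δ K b b'' * + 1)
        ≡⟨ FF.Σ-const _ ⟩
      + q * (+ 1 - δ K b b'' * + 1) ∎
    left : (I⊗Jq² · N β) ≋ ((+ q) ⊙ (Jₘ ⊖ I⊗Jq²))
    left (b , r) (b'' , a₁'' , a₂'') = begin
      (I⊗Jq² · N β) (b , r) (b'' , a₁'' , a₂'')
        ≡⟨ blockDiagonal-· (N β) allOnes I⊗Jq²-blocks b r (b'' , a₁'' , a₂'') ⟩
      Σ² (λ r' → + 1 * N β (b , r') (b'' , a₁'' , a₂''))
        ≡⟨ Σ²-allOnesˡ (λ r' → N β (b , r') (b'' , a₁'' , a₂'')) ⟩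
      Σ[ F ] (λ t → Σ[ F ] (λ s → N β (b , t , s) (b'' , a₁'' , a₂'')))
        ≡⟨ FF.Σ-cong (λ t → N-column b t b'' (a₁'' , a₂'') β≢0) ⟩
      Σ[ F ] (λ t → + 1 - δ K b b'' * + 1)
        ≡⟨ FF.Σ-const _ ⟩
      + q * (+ 1 - δ K b b'' * + 1) ∎

  N·N : ∀ β β' b p b'' p'' → (N β · N β') (b , p) (b'' , p'')
    ≡ Σ[ K ] (λ b' → paths (φ (β *K (b' -K b))) (φ (β' *K (b'' -K b'))) p p'')
  N·N β β' b p b'' p'' = KF.Σ-cong (λ b' → FF.Σ-cong (λ t → FF.Σ-cong (λ s →
    cong₂ _*_ (N-entry β b p b' (t , s)) (N-entry β' b' (t , s) b'' p''))))

  paths-φ : ∀ {x₁ x₂} p p'' → x₁ ≢ 0K → x₂ ≢ 0K →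
    paths (φ x₁) (φ x₂) p p'' ≡ + 1 + δ K x₁ x₂ * (+ q * incidence (φ x₁) p p'' - + 1)
  paths-φ {x₁} {x₂} p p'' x₁≢0 x₂≢0 with φ-nonzero x₁≢0 | φ-nonzero x₂≢0
  ... | c₁ , e₁ | c₂ , e₂ rewrite e₁ | e₂ = begin
    paths (just c₁) (just c₂) p p''   ≡⟨ by-slopes (c₁ ≟F c₂) ⟩
    + 1 + δ F c₁ c₂ * Y               ≡⟨ cong (λ d → + 1 + d * Y) (δ-φ e₁ e₂) ⟩
    + 1 + δ K x₁ x₂ * Y               ∎
    where
    Y : ℤ
    Y = + q * onLine c₁ p p'' - + 1
    by-slopes : Dec (c₁ ≡ c₂) → paths (just c₁) (just c₂) p p'' ≡ + 1 + δ F c₁ c₂ * Y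
    by-slopes (yes refl) = begin
      paths (just c₁) (just c₁) p p''   ≡⟨ paths-same c₁ p p'' ⟩
      + q * onLine c₁ p p''             ≡⟨ one-path (+ q * onLine c₁ p p'') ⟩
      + 1 + + 1 * Y                     ≡⟨ cong (λ d → + 1 + d * Y) (FF.δ-yes refl) ⟨
      + 1 + δ F c₁ c₁ * Y               ∎
      where
      one-path : ∀ n → n ≡ + 1 + + 1 * (n - + 1)
      one-path = solve-∀
    by-slopes (no c₁≢c₂) = begin
      paths (just c₁) (just c₂) p p''   ≡⟨ paths-distinct c₁ c₂ p p'' c₁≢c₂ ⟩
      + 1                               ≡⟨ no-correction Y ⟩
      + 1 + + 0 * Y                     ≡⟨ cong (λ d → + 1 + d * Y) (FF.δ-no c₁≢c₂) ⟨
      + 1 + δ F c₁ c₂ * Y               ∎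
      where
      no-correction : ∀ n → + 1 ≡ + 1 + + 0 * n
      no-correction = solve-∀

  -- for b ≠ b'', the middle block b' of N_β N_β' carries one path unless
  -- b' ∈ {b, b''}, corrected where the slopes of the two steps agree
  agree : 𝕂 → 𝕂 → 𝕂 → 𝕂 → 𝕂 → ℤ
  agree β β' b b'' b' = δ K (β *K (b' -K b)) (β' *K (b'' -K b'))

  excess : 𝕂 → 𝕂 → Point → Point → 𝕂 → ℤ
  excess β b p p'' b' = + q * incidence (φ (β *K (b' -K b))) p p'' - + 1

  summand-offDiagonal : ∀ {β β'} b b'' p p'' → β ≢ 0K → β' ≢ 0K → b ≢ b'' → ∀ b' →
    paths (φ (β *K (b' -K b))) (φ (β' *K (b'' -K b'))) p p''
      ≡ + 1 - δ K b' b - δ K b' b'' + agree β β' b b'' b' * excess β b p p'' b'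
  summand-offDiagonal {β} {β'} b b'' p p'' β≢0 β'≢0 b≢b'' b' with b' ≟K b | b' ≟K b''
  ... | yes refl | yes b≡b'' = ⊥-elim (b≢b'' b≡b'')
  ... | yes refl | no _ = begin
    paths (φ (β *K (b -K b))) (φ (β' *K (b'' -K b))) p p''
      ≡⟨ cong (λ m → paths m (φ (β' *K (b'' -K b))) p p'') (diagonal-slope β b) ⟩
    paths nothing (φ (β' *K (b'' -K b))) p p''
      ≡⟨ paths-nothingˡ (φ (β' *K (b'' -K b))) p p'' ⟩
    + 0
      ≡⟨ cong (λ d → + 0 + d * excess β b p p'' b) (KF.δ-no λ e →
           KF.affine-nonzero β'≢0 (b≢b'' ∘ sym) (trans (sym e) (KF.affine-self β b))) ⟨
    + 0 + agree β β' b b'' b * excess β b p p'' b ∎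
  ... | no b'≢b | yes refl = begin
    paths (φ (β *K (b' -K b))) (φ (β' *K (b' -K b'))) p p''
      ≡⟨ cong (λ m → paths (φ (β *K (b' -K b))) m p p'') (diagonal-slope β' b') ⟩
    paths (φ (β *K (b' -K b))) nothing p p''
      ≡⟨ paths-nothingʳ (φ (β *K (b' -K b))) p p'' ⟩
    + 0
      ≡⟨ cong (λ d → + 0 + d * excess β b p p'' b') (KF.δ-no λ e →
           KF.affine-nonzero β≢0 b'≢b (trans e (KF.affine-self β' b'))) ⟨
    + 0 + agree β β' b b' b' * excess β b p p'' b' ∎
  ... | no b'≢b | no b'≢b'' =
    paths-φ p p'' (KF.affine-nonzero β≢0 b'≢b) (KF.affine-nonzero β'≢0 (b'≢b'' ∘ sym))

  N·N-offDiagonal : ∀ {β β'} b b'' p p'' → β ≢ 0K → β' ≢ 0K → b ≢ b'' →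
    (N β · N β') (b , p) (b'' , p'') ≡ (+ q - + 1) + Σ[ K ] (λ b' → agree β β' b b'' b' * excess β b p p'' b')
  N·N-offDiagonal {β} {β'} b b'' p p'' β≢0 β'≢0 b≢b'' = begin
    (N β · N β') (b , p) (b'' , p'')
      ≡⟨ N·N β β' b p b'' p'' ⟩
    Σ[ K ] (λ b' → paths (φ (β *K (b' -K b))) (φ (β' *K (b'' -K b'))) p p'')
      ≡⟨ KF.Σ-cong (summand-offDiagonal b b'' p p'' β≢0 β'≢0 b≢b'') ⟩
    Σ[ K ] (λ b' → (+ 1 - δ K b' b - δ K b' b'') + correction b')
      ≡⟨ KF.Σ-+ (λ b' → + 1 - δ K b' b - δ K b' b'') correction ⟩
    Σ[ K ] (λ b' → + 1 - δ K b' b - δ K b' b'') + Σ[ K ] correction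
      ≡⟨ cong (λ n → n + Σ[ K ] correction) count ⟩
    (+ q - + 1) + Σ[ K ] correction ∎
    where
    correction : 𝕂 → ℤ
    correction b' = agree β β' b b'' b' * excess β b p p'' b'
    count : Σ[ K ] (λ b' → + 1 - δ K b' b - δ K b' b'') ≡ + q - + 1
    count = begin
      Σ[ K ] (λ b' → + 1 - δ K b' b - δ K b' b'')
        ≡⟨ KF.Σ-- (λ b' → + 1 - δ K b' b) (λ b' → δ K b' b'') ⟩
      Σ[ K ] (λ b' → + 1 - δ K b' b) - Σ[ K ] (λ b' → δ K b' b'')
        ≡⟨ cong₂ _-_ (KF.Σ-- (λ _ → + 1) (λ b' → δ K b' b)) (KF.Σ-δ b'') ⟩
      Σ[ K ] (λ _ → + 1) - Σ[ K ] (λ b' → δ K b' b) - + 1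
        ≡⟨ cong (λ n → Σ[ K ] (λ _ → + 1) - n - + 1) (KF.Σ-δ b) ⟩
      Σ[ K ] (λ _ → + 1) - + 1 - + 1
        ≡⟨ cong (λ n → n - + 1 - + 1) (KF.Σ-const (+ 1)) ⟩
      + suc q * + 1 - + 1 - + 1
        ≡⟨ arithmetic (+ q) ⟩
      + q - + 1 ∎
      where
      arithmetic : ∀ Q → (+ 1 + Q) * + 1 - + 1 - + 1 ≡ Q - + 1
      arithmetic = solve-∀

  -- (ii): N_β N_{-β} = q² I - q I ⊗ J_q + I ⊗ J_{q²} + (q - 1) J.  On the
  -- diagonal blocks both steps use the same slope; off them the slopes never agree
  part-ii : ∀ {β} → β ≢ 0K →
    (N β · N (negK β)) ≋ (((((+ q) ⊙ ((+ q) ⊙ Iₘ)) ⊖ ((+ q) ⊙ I⊗Jq)) ⊕ I⊗Jq²) ⊕ ((+ q - + 1) ⊙ Jₘ))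
  part-ii {β} β≢0 (b , a₁ , a₂) (b'' , a₁'' , a₂'') with b ≟K b''
  ... | yes refl = begin
    (N β · N (negK β)) (b , p) (b , p'')
      ≡⟨ N·N β (negK β) b p b p'' ⟩
    Σ[ K ] (λ b' → paths (φ (β *K (b' -K b))) (φ (negK β *K (b -K b'))) p p'')
      ≡⟨ KF.Σ-cong (λ b' → trans (cong (λ x → paths (φ (β *K (b' -K b))) (φ x) p p'') (KF.affine-opposite β b b'))
                                 (paths-self (φ (β *K (b' -K b))) p p'')) ⟩
    Σ[ K ] (λ b' → + q * incidence (φ (β *K (b' -K b))) p p'')
      ≡⟨ KF.Σ-*ˡ (+ q) (λ b' → incidence (φ (β *K (b' -K b))) p p'') ⟩
    + q * Σ[ K ] (λ b' → incidence (φ (β *K (b' -K b))) p p'')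
      ≡⟨ cong (+ q *_) (pencil b p p'' β≢0) ⟩
    + q * pencilCount p p''
      ≡⟨ arithmetic (+ q) (δ F a₁ a₁'') (δ F a₂ a₂'') ⟩
    + q * (+ q * (+ 1 * δ F a₁ a₁'' * δ F a₂ a₂'')) - + q * (+ 1 * δ F a₁ a₁'' * + 1) + + 1 * + 1 + (+ q - + 1) * + 1 ∎
    where
    p p'' : Point
    p = (a₁ , a₂)
    p'' = (a₁'' , a₂'')
    arithmetic : ∀ Q d₁ d₂ → Q * (Q * (d₁ * d₂) + (+ 1 - d₁))
      ≡ Q * (Q * (+ 1 * d₁ * d₂)) - Q * (+ 1 * d₁ * + 1) + + 1 * + 1 + (Q - + 1) * + 1
    arithmetic = solve-∀
  ... | no b≢b'' = begin
    (N β · N (negK β)) (b , p) (b'' , p'')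
      ≡⟨ N·N-offDiagonal b b'' p p'' β≢0 (KF.neg-nonzero β≢0) b≢b'' ⟩
    (+ q - + 1) + Σ[ K ] (λ b' → agree β (negK β) b b'' b' * excess β b p p'' b')
      ≡⟨ cong (λ n → (+ q - + 1) + n) (KF.Σ-zero _ never-agree) ⟩
    (+ q - + 1) + + 0
      ≡⟨ arithmetic (+ q) (δ F a₁ a₁'') (δ F a₂ a₂'') ⟩
    + q * (+ q * (+ 0 * δ F a₁ a₁'' * δ F a₂ a₂'')) - + q * (+ 0 * δ F a₁ a₁'' * + 1) + + 0 * + 1 + (+ q - + 1) * + 1 ∎
    where
    p p'' : Point
    p = (a₁ , a₂)
    p'' = (a₁'' , a₂'')
    never-agree : ∀ b' → agree β (negK β) b b'' b' * excess β b p p'' b' ≡ + 0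
    never-agree b' = cong (_* excess β b p p'' b')
      (trans (KF.δ-opposite b' b b'' β≢0) (KF.δ-no (b≢b'' ∘ sym)))
    arithmetic : ∀ Q d₁ d₂ → Q - + 1 + + 0
      ≡ Q * (Q * (+ 0 * d₁ * d₂)) - Q * (+ 0 * d₁ * + 1) + + 0 * + 1 + (Q - + 1) * + 1
    arithmetic = solve-∀

  -- Off the diagonal blocks the two slopes agree at exactly
  -- one middle block b₀, where the step through b₀ has slope φ(γ(b'' - b))
  part-iii : ∀ {β β'} → β ≢ 0K → β' ≢ 0K → (β +K β') ≢ 0K →
    (N β · N β') ≋ ((((+ q) ⊙ N ((β ×K β') /K (β +K β'))) ⊕ ((+ 2) ⊙ I⊗Jq²)) ⊕ ((+ q - + 2) ⊙ Jₘ))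
  part-iii {β} {β'} β≢0 β'≢0 s≢0 (b , a₁ , a₂) (b'' , p'') with b ≟K b''
  ... | yes refl = begin
    (N β · N β') (b , p) (b , p'')
      ≡⟨ N·N β β' b p b p'' ⟩
    Σ[ K ] (λ b' → paths (φ (β *K (b' -K b))) (φ (β' *K (b -K b'))) p p'')
      ≡⟨ KF.Σ-cong summand-diagonal ⟩
    Σ[ K ] (λ b' → + 1 - δ K b' b)
      ≡⟨ KF.Σ-- (λ _ → + 1) (λ b' → δ K b' b) ⟩
    Σ[ K ] (λ _ → + 1) - Σ[ K ] (λ b' → δ K b' b)
      ≡⟨ cong₂ _-_ (KF.Σ-const (+ 1)) (KF.Σ-δ b) ⟩
    + suc q * + 1 - + 1
      ≡⟨ arithmetic (+ q) ⟩
    + q * + 0 + + 2 * (+ 1 * + 1) + (+ q - + 2) * + 1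
      ≡⟨ cong (λ n → + q * n + + 2 * (+ 1 * + 1) + (+ q - + 2) * + 1) γ-diagonal ⟨
    + q * N γ (b , p) (b , p'') + + 2 * (+ 1 * + 1) + (+ q - + 2) * + 1 ∎
    where
    p : Point
    p = (a₁ , a₂)
    γ : 𝕂
    γ = (β ×K β') /K (β +K β')
    γ-diagonal : N γ (b , p) (b , p'') ≡ + 0
    γ-diagonal = trans (N-entry γ b p b p'') (cong (λ m → incidence m p p'') (diagonal-slope γ b))
    -- within a block the two slopes agree only at b' = b, where there is no path
    summand-diagonal : ∀ b' → paths (φ (β *K (b' -K b))) (φ (β' *K (b -K b'))) p p'' ≡ + 1 - δ K b' b
    summand-diagonal b' with b' ≟K b
    ... | yes refl = trans (cong (λ m → paths m (φ (β' *K (b' -K b'))) p p'') (diagonal-slope β b'))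
                           (paths-nothingˡ (φ (β' *K (b' -K b'))) p p'')
    ... | no b'≢b = begin
      paths (φ (β *K (b' -K b))) (φ (β' *K (b -K b'))) p p''
        ≡⟨ paths-φ p p'' (KF.affine-nonzero β≢0 b'≢b) (KF.affine-nonzero β'≢0 (b'≢b ∘ sym)) ⟩
      + 1 + agree β β' b b b' * excess β b p p'' b'
        ≡⟨ cong (λ d → + 1 + d * excess β b p p'' b') slopes-differ ⟩
      + 1 + + 0 * excess β b p p'' b'
        ≡⟨ ℤP.+-identityʳ (+ 1) ⟩
      + 1 ∎
      where
      slopes-differ : agree β β' b b b' ≡ + 0
      slopes-differ = trans (KF.δ-meeting b' b b s≢0)
                            (trans (cong (δ K b') (KF.meeting-diagonal b s≢0)) (KF.δ-no b'≢b))
    arithmetic : ∀ Q → (+ 1 + Q) * + 1 - + 1 ≡ Q * + 0 + + 2 * (+ 1 * + 1) + (Q - + 2) * + 1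
    arithmetic = solve-∀
  ... | no b≢b'' = begin
    (N β · N β') (b , p) (b'' , p'')
      ≡⟨ N·N-offDiagonal b b'' p p'' β≢0 β'≢0 b≢b'' ⟩
    (+ q - + 1) + Σ[ K ] (λ b' → agree β β' b b'' b' * excess β b p p'' b')
      ≡⟨ cong (λ n → (+ q - + 1) + n) meet-once ⟩
    (+ q - + 1) + (+ q * N γ (b , p) (b'' , p'') - + 1)
      ≡⟨ arithmetic (+ q) (N γ (b , p) (b'' , p'')) ⟩
    + q * N γ (b , p) (b'' , p'') + + 2 * (+ 0 * + 1) + (+ q - + 2) * + 1 ∎
    where
    p : Point
    p = (a₁ , a₂)
    γ b₀ : 𝕂
    γ = (β ×K β') /K (β +K β')
    b₀ = KF.meeting-point β β' b b''
    meet-once : Σ[ K ] (λ b' → agree β β' b b'' b' * excess β b p p'' b') ≡ + q * N γ (b , p) (b'' , p'') - + 1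
    meet-once = begin
      Σ[ K ] (λ b' → agree β β' b b'' b' * excess β b p p'' b')
        ≡⟨ KF.Σ-cong (λ b' → cong (_* excess β b p p'' b') (KF.δ-meeting b' b b'' s≢0)) ⟩
      Σ[ K ] (λ b' → δ K b' b₀ * excess β b p p'' b')
        ≡⟨ KF.Σ-δ* b₀ (excess β b p p'') ⟩
      + q * incidence (φ (β *K (b₀ -K b))) p p'' - + 1
        ≡⟨ cong (λ x → + q * incidence (φ x) p p'' - + 1) (KF.meeting-value b b'' s≢0) ⟩
      + q * incidence (φ (γ *K (b'' -K b))) p p'' - + 1
        ≡⟨ cong (λ n → + q * n - + 1) (N-entry γ b p b'' p'') ⟨
      + q * N γ (b , p) (b'' , p'') - + 1 ∎
    arithmetic : ∀ Q X → Q - + 1 + (Q * X - + 1) ≡ Q * X + + 2 * (+ 0 * + 1) + (Q - + 2) * + 1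
    arithmetic = solve-∀

proposition4p1 : (q : ℕ) (F : FiniteField q) (K : FiniteField (suc q))
    (φ : FiniteField.Carrier K → Maybe (FiniteField.Carrier F))
    → Bijective _≡_ _≡_ φ
    → φ (FiniteField.0ᶠ K) ≡ nothing
    → let open Setting F K φ in ((β : FiniteField.Carrier K) → β ≢ 0K → transpose (N β) ≋ N (negK β))
       × ((β : FiniteField.Carrier K) → β ≢ 0K →
            (N β · N (negK β)) ≋ (((((+ q) ⊙ ((+ q) ⊙ Iₘ)) ⊖ ((+ q) ⊙ I⊗Jq)) ⊕ I⊗Jq²)
                                 ⊕ ((+ q - + 1) ⊙ Jₘ)))
       × ((β β' : FiniteField.Carrier K) → β ≢ 0K → β' ≢ 0K → (β +K β') ≢ 0K →
            (N β · N β') ≋ ((((+ q) ⊙ N ((β ×K β') /K (β +K β'))) ⊕ ((+ 2) ⊙ I⊗Jq²))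
                            ⊕ ((+ q - + 2) ⊙ Jₘ)))
       × ((β : FiniteField.Carrier K) → β ≢ 0K →
            ((N β · I⊗Jq) ≋ (Jₘ ⊖ I⊗Jq²)) × ((I⊗Jq · N β) ≋ (Jₘ ⊖ I⊗Jq²)))
       × ((β : FiniteField.Carrier K) → β ≢ 0K →
            ((N β · I⊗Jq²) ≋ ((+ q) ⊙ (Jₘ ⊖ I⊗Jq²)))
            × ((I⊗Jq² · N β) ≋ ((+ q) ⊙ (Jₘ ⊖ I⊗Jq²))))
       × (ΣK* N ≋ rhs-vi)
proposition4p1 q F K φ φ-bijective φ-0 =
    (λ β _ → part-i β)
  , (λ β → part-ii {β})
  , (λ β β' → part-iii {β} {β'})
  , (λ β → part-iv {β})
  , (λ β → part-v {β})
  , part-vi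
  where open MatrixIdentities F K φ φ-bijective φ-0
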